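{- (1) For all $\mathbf{k},\mathbf{m}\in\mathbb{N}[\Phi]^W$ we have $\eta_{\mathbf{k}+\mathbf{m}}=\eta_{\mathbf{m}}\circ\eta_{\mathbf{k}}$. (2) For every $\mathbf{k}\in\mathbb{N}[\Phi]^W$, the map $\eta_{\mathbf{k}}\colon P\to P$ is injective.
   Context: Let $V$ be a finite-dimensional real inner product space and $\Phi\subseteq V$ an irreducible (reduced, crystallographic) root system spanning $V$, with simple roots $\alpha_1,\dots,\alpha_n$, simple reflections $s_i=s_{\alpha_i}$, coroots $\alpha^\vee=2\alpha/\langle\alpha,\alpha\rangle$, Weyl group $W$, fundamental weights $\omega_i$ ($\langle\omega_i,\alpha_j^\vee\rangle=\delta_{ij}$), weight lattice $P=\bigoplus\mathbb{Z}\omega_i$, dominant weights $P_{\ge0}=\sum\mathbb{Z}_{\ge0}\omega_i$. $\mathbb{N}[\Phi]^W$ is the set of $W$-invariant functions $\mathbf{k}\colon\Phi\to\mathbb{Z}_{\ge0}$, added pointwise. $\rho_{\mathbf{k}}=\sum_i\mathbf{k}(\alpha_i)\omega_i$. For $\lambda\in P$, $w_\lambda$ is the unique minimal-length element (length with respect to the $s_i$) of $\{w\in W:w^{ -1}(\lambda)\in P_{\ge0}\}$, and $\eta_{\mathbf{k}}(\lambda)=\lambda+w_\lambda(\rho_{\mathbf{k}})$.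
   Formalization: The space $V$ is taken as ℚ^d with an inner product whose values on ℚ^d are rational, instead of a finite-dimensional real inner product space. -}

module Defs where

open import Data.Nat using (ℕ; zero; suc) renaming (_≤_ to _≤ℕ_; _+_ to _+ℕ_)
open import Data.Integer using (ℤ)
import Data.Integer as ℤ
open import Data.Rational using (ℚ; 0ℚ; 1ℚ; _+_; _*_; -_; _-_; _÷_; _<_; _≟_; ≢-nonZero)
import Data.Rational as Q
open import Data.Fin using (Fin)
import Data.Fin as F
open import Data.List using (List; []; _∷_; length; lookup; reverse)
open import Data.List.Relation.Unary.Any using (Any)
open import Data.Product using (Σ; ∃; _×_; _,_)
open import Data.Sum using (_⊎_)
open import Data.Bool using (Bool)
open import Relation.Binary.PropositionalEquality using (_≡_; _≢_)
open import Relation.Nullary using (¬_; yes; no)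

ℕ→ℚ : ℕ → ℚ
ℕ→ℚ n = (ℤ.+ n) Q./ 1

ℤ→ℚ : ℤ → ℚ
ℤ→ℚ z = z Q./ 1

-- total division (x / 0 := 0); only ever used with nonzero divisors
_÷'_ : ℚ → ℚ → ℚ
x ÷' y with y ≟ 0ℚ
... | yes _ = 0ℚ
... | no y≢0 = _÷_ x y {{≢-nonZero y≢0}}

Σℚ : {n : ℕ} → (Fin n → ℚ) → ℚ
Σℚ {zero} f = 0ℚ
Σℚ {suc n} f = f F.zero + Σℚ (λ i → f (F.suc i))

δ : {n : ℕ} → Fin n → Fin n → ℚ
δ i j with i F.≟ j
... | yes _ = 1ℚ
... | no _ = 0ℚ

Vec : ℕ → Set
Vec d = Fin d → ℚ

module _ {d : ℕ} where

  0V : Vec d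
  0V _ = 0ℚ

  _+V_ : Vec d → Vec d → Vec d
  (x +V y) i = x i + y i

  -V_ : Vec d → Vec d
  (-V x) i = - x i

  _·V_ : ℚ → Vec d → Vec d
  (c ·V x) i = c * x i

  _≈V_ : Vec d → Vec d → Set
  x ≈V y = ∀ i → x i ≡ y i

  lincomb : {m : ℕ} → (Fin m → ℚ) → (Fin m → Vec d) → Vec d
  lincomb c v i = Σℚ (λ j → c j * v j i)

Gram : ℕ → Set
Gram d = Fin d → Fin d → ℚ

module IP {d : ℕ} (G : Gram d) where

  ⟨_,_⟩ : Vec d → Vec d → ℚ
  ⟨ x , y ⟩ = Σℚ (λ i → Σℚ (λ j → x i * (G i j * y j)))

  IsInnerProduct : Set
  IsInnerProduct = (∀ i j → G i j ≡ G j i)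
                 × (∀ x → ¬ (x ≈V 0V) → 0ℚ < ⟨ x , x ⟩)

  coroot : Vec d → Vec d
  coroot α = ((ℕ→ℚ 2) ÷' ⟨ α , α ⟩) ·V α

  refl' : Vec d → Vec d → Vec d
  refl' α v = v +V (-V (⟨ v , coroot α ⟩ ·V α))

  _∈L_ : Vec d → List (Vec d) → Set
  v ∈L Φ = Any (λ γ → γ ≈V v) Φ

  record IsRootSystem (Φ : List (Vec d)) : Set where
    field
      innerProduct : IsInnerProduct
      nonzero      : ∀ α → α ∈L Φ → ¬ (α ≈V 0V)
      spans        : ∀ v → Σ (Fin (length Φ) → ℚ) λ c → v ≈V lincomb c (lookup Φ)
      reflClosed   : ∀ α β → α ∈L Φ → β ∈L Φ → refl' α β ∈L Φ
      crystal      : ∀ α β → α ∈L Φ → β ∈L Φ → Σ ℤ λ z → ⟨ β , coroot α ⟩ ≡ ℤ→ℚ z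
      reduced      : ∀ α c → α ∈L Φ → (c ·V α) ∈L Φ → (c ≡ 1ℚ) ⊎ (c ≡ - 1ℚ)
      irreducible  : ¬ (Σ (Fin (length Φ) → Bool) λ S →
                        (Σ (Fin (length Φ)) λ i → S i ≡ Bool.true)
                      × (Σ (Fin (length Φ)) λ i → S i ≡ Bool.false)
                      × (∀ i j → S i ≢ S j → ⟨ lookup Φ i , lookup Φ j ⟩ ≡ 0ℚ))

  record IsBase (Φ : List (Vec d)) (α : Fin d → Vec d) : Set where
    field
      simpleRoots : ∀ i → α i ∈L Φ
      linIndep    : ∀ (c : Fin d → ℚ) → lincomb c α ≈V 0V → ∀ i → c i ≡ 0ℚ
      signed      : ∀ β → β ∈L Φ → Σ (Fin d → ℕ) λ c →
                      (β ≈V lincomb (λ i → ℕ→ℚ (c i)) α)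
                    ⊎ (β ≈V (-V lincomb (λ i → ℕ→ℚ (c i)) α))

  IsFundWeights : (α : Fin d → Vec d) → (Fin d → Vec d) → Set
  IsFundWeights α ω = ∀ i j → ⟨ ω i , coroot (α j) ⟩ ≡ δ i j

  module Weyl (α : Fin d → Vec d) (ω : Fin d → Vec d) where

    s : Fin d → Vec d → Vec d
    s i = refl' (α i)

    act : List (Fin d) → Vec d → Vec d
    act [] v = v
    act (i ∷ u) v = s i (act u v)

    -- action of the inverse element w⁻¹ = s_{i_r} ⋯ s_{i₁}
    actInv : List (Fin d) → Vec d → Vec d
    actInv u = act (reverse u)

    InP : Vec d → Set
    InP λ' = Σ (Fin d → ℤ) λ c → λ' ≈V lincomb (λ i → ℤ→ℚ (c i)) ω

    Dominant : Vec d → Set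
    Dominant λ' = Σ (Fin d → ℕ) λ c → λ' ≈V lincomb (λ i → ℕ→ℚ (c i)) ω

    -- u represents w_λ: w⁻¹(λ) dominant and of minimal length among all such w
    IsMinWord : Vec d → List (Fin d) → Set
    IsMinWord λ' u = Dominant (actInv u λ')
                   × (∀ u' → Dominant (actInv u' λ') → length u ≤ℕ length u')

    -- W-invariant multiplicity functions k : Φ → ℕ (values off Φ are irrelevant)
    IsWInvariant : List (Vec d) → (Vec d → ℕ) → Set
    IsWInvariant Φ k = ∀ β β' (u : List (Fin d)) → β ∈L Φ → act u β ≈V β' → k β' ≡ k β

    _⊕_ : (Vec d → ℕ) → (Vec d → ℕ) → (Vec d → ℕ)
    (k ⊕ m) β = k β +ℕ m β

    ρ : (Vec d → ℕ) → Vec d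
    ρ k = lincomb (λ i → ℕ→ℚ (k (α i))) ω

    -- graph of η_k: η_k(λ) = μ  iff  μ = λ + w_λ(ρ_k)
    Eta : (Vec d → ℕ) → Vec d → Vec d → Set
    Eta k λ' μ = Σ (List (Fin d)) λ u → IsMinWord λ' u × (μ ≈V (λ' +V act u (ρ k)))

{-# OPTIONS --safe #-}
-- Let w = w_λ. Since w⁻¹λ and ρ_k are dominant, so is w⁻¹(η_k λ) = w⁻¹λ + ρ_k. If also v⁻¹(η_k λ) is
-- dominant, then v⁻¹w sends the sum of the dominant weights w⁻¹λ and ρ_k to a dominant weight, hence
-- fixes both summands; so v⁻¹λ is dominant and ℓ(v) ≥ ℓ(w). Hence w is also minimal for η_k λ.
-- Minimal elements are unique: the first letter s_i of a minimal word for μ has ⟨μ, α_i^∨⟩ < 0, and by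
-- the exchange condition it can be split off every other minimal word for μ. Therefore
-- η_m(η_k λ) = λ + w ρ_k + w ρ_m = η_{k+m} λ, and η_k λ = η_k λ′ = μ gives λ = μ − w_μ ρ_k = λ′.
module Submission where

open import Defs
open import Data.Nat using (ℕ; zero; suc; s≤s) renaming (_+_ to _+ℕ_; _≤_ to _≤ℕ_)
import Data.Nat.Properties as ℕP
open import Data.Nat.Coprimality using (1-coprimeTo) renaming (sym to coprime-sym)
import Data.Integer as ℤ
import Data.Integer.Properties as ℤP
import Data.Rational as ℚ
open import Data.Rational
  using (ℚ; 0ℚ; 1ℚ; _+_; _*_; -_; _-_; _<_; _≤_; _≟_; ≢-nonZero; mkℚ; 1/_; positive; nonNegative)
import Data.Rational.Properties as ℚP
open import Data.Rational.Solver using (module +-*-Solver)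
open import Data.Fin using (Fin)
import Data.Fin as F
import Data.Fin.Properties as FP
open import Data.Product using (Σ; _×_; _,_; proj₁; proj₂)
open import Data.Sum using (_⊎_; inj₁; inj₂)
open import Data.Empty using (⊥; ⊥-elim)
open import Data.List using (List; []; _∷_; _++_; length; reverse)
import Data.List.Properties as ListP
import Data.List.Relation.Unary.Any as Any
open import Algebra.Bundles using (Ring)
open import Algebra.Properties.Semiring.Sum (Ring.semiring ℚP.+-*-ring)
  using (sum; sum-cong-≗; sum-replicate-zero; ∑-distrib-+; ∑-comm; *-distribˡ-sum)
open import Relation.Binary.Bundles using (Setoid)
import Relation.Binary.Reasoning.Setoid
open import Relation.Binary.Definitions using (tri<; tri≈; tri>)
open import Relation.Binary.PropositionalEquality
  using (_≡_; _≢_; refl; sym; trans; cong; cong₂; subst; _→-setoid_; module ≡-Reasoning)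
open import Relation.Nullary using (¬_; yes; no)
open import Function using (_∘_)
open +-*-Solver

ℕ→ℚ≡mkℚ : ∀ n → ℕ→ℚ n ≡ mkℚ (ℤ.+ n) 0 (coprime-sym (1-coprimeTo n))
ℕ→ℚ≡mkℚ n = ℚP.normalize-coprime (coprime-sym (1-coprimeTo n))

ℕ→ℚ-+ : ∀ a b → ℕ→ℚ (a +ℕ b) ≡ ℕ→ℚ a + ℕ→ℚ b
-- On normal forms, _+_ computes to (a * 1 + b * 1) / 1.
ℕ→ℚ-+ a b rewrite ℕ→ℚ≡mkℚ a | ℕ→ℚ≡mkℚ b =
  cong (ℚ._/ 1) (sym (cong₂ ℤ._+_ (ℤP.*-identityʳ (ℤ.+ a)) (ℤP.*-identityʳ (ℤ.+ b))))

ℕ→ℚ-nonNeg : ∀ n → 0ℚ ≤ ℕ→ℚ n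
ℕ→ℚ-nonNeg n rewrite ℕ→ℚ≡mkℚ n = ℚP.nonNegative⁻¹ _

ℕ→ℚ≢-1 : ∀ n → ℕ→ℚ n ≢ - 1ℚ
ℕ→ℚ≢-1 n eq rewrite ℕ→ℚ≡mkℚ n with cong ℚ.↥_ eq
... | ()

-- two is definitionally 1ℚ + 1ℚ, so the ring solver may write it as con 1ℚ :+ con 1ℚ.
two : ℚ
two = ℕ→ℚ 2

p+q≤0⇒p≡0 : ∀ {p q} → 0ℚ ≤ p → 0ℚ ≤ q → p + q ≤ 0ℚ → p ≡ 0ℚ
p+q≤0⇒p≡0 {p} 0≤p 0≤q p+q≤0 =
  ℚP.≤-antisym (ℚP.≤-trans (subst (_≤ p + _) (ℚP.+-identityʳ p) (ℚP.+-monoʳ-≤ p 0≤q)) p+q≤0) 0≤p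

ℕ→ℚ-sum≡0 : ∀ m n → ℕ→ℚ m + ℕ→ℚ n ≡ 0ℚ → ℕ→ℚ m ≡ 0ℚ
ℕ→ℚ-sum≡0 m n sum≡0 = p+q≤0⇒p≡0 (ℕ→ℚ-nonNeg m) (ℕ→ℚ-nonNeg n) (ℚP.≤-reflexive sum≡0)

nonNeg*nonNeg : ∀ {p q} → 0ℚ ≤ p → 0ℚ ≤ q → 0ℚ ≤ p * q
nonNeg*nonNeg {p} {q} 0≤p 0≤q =
  ℚP.nonNegative⁻¹ _ {{ℚP.nonNeg*nonNeg⇒nonNeg p {{nonNegative 0≤p}} q {{nonNegative 0≤q}}}}

pos*nonPos : ∀ {c p} → 0ℚ < c → p ≤ 0ℚ → c * p ≤ 0ℚ
pos*nonPos {c} 0<c p≤0 =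
  subst (c * _ ≤_) (ℚP.*-zeroʳ c) (ℚP.*-monoˡ-≤-nonNeg c {{nonNegative (ℚP.<⇒≤ 0<c)}} p≤0)

pos*-nonNeg⁻¹ : ∀ {c p} → 0ℚ < c → 0ℚ ≤ c * p → 0ℚ ≤ p
pos*-nonNeg⁻¹ {c} 0<c 0≤cp =
  ℚP.*-cancelˡ-≤-pos c {{positive 0<c}} (subst (_≤ c * _) (sym (ℚP.*-zeroʳ c)) 0≤cp)

≤0∧≢0⇒<0 : ∀ {p} → p ≤ 0ℚ → p ≢ 0ℚ → p < 0ℚ
≤0∧≢0⇒<0 {p} p≤0 p≢0 with ℚP.<-cmp p 0ℚ
... | tri< p<0 _ _ = p<0
... | tri≈ _ p≡0 _ = ⊥-elim (p≢0 p≡0)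
... | tri> _ _ p>0 = ⊥-elim (ℚP.<-irrefl refl (ℚP.<-≤-trans p>0 p≤0))

neg-involutive : ∀ p → - (- p) ≡ p
neg-involutive = solve 1 (λ p → :- (:- p) := p) refl

÷'-*-cancel : ∀ p {q} → q ≢ 0ℚ → (p ÷' q) * q ≡ p
÷'-*-cancel p {q} q≢0 with q ≟ 0ℚ
... | yes q≡0 = ⊥-elim (q≢0 q≡0)
... | no q≢0′ = trans (ℚP.*-assoc p _ q)
  (trans (cong (p *_) (ℚP.*-inverseˡ q {{≢-nonZero q≢0′}})) (ℚP.*-identityʳ p))

÷'-pos : ∀ {p q} → 0ℚ < p → 0ℚ < q → 0ℚ < p ÷' q
÷'-pos {p} {q} 0<p 0<q with q ≟ 0ℚ
... | yes q≡0 = ⊥-elim (ℚP.<-irrefl (sym q≡0) 0<q)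
... | no q≢0 = ℚP.positive⁻¹ _ {{ℚP.pos*pos⇒pos p {{positive 0<p}}
  ((1/ q) {{≢-nonZero q≢0}}) {{ℚP.1/pos⇒pos q {{positive 0<q}}}}}}

Σℚ≡sum : ∀ {n} (f : Fin n → ℚ) → Σℚ f ≡ sum f
Σℚ≡sum {zero} f = refl
Σℚ≡sum {suc n} f = cong (f F.zero +_) (Σℚ≡sum (λ i → f (F.suc i)))

Σℚ-cong : ∀ {n} {f g : Fin n → ℚ} → (∀ i → f i ≡ g i) → Σℚ f ≡ Σℚ g
Σℚ-cong {f = f} {g} f≗g = trans (Σℚ≡sum f) (trans (sum-cong-≗ f≗g) (sym (Σℚ≡sum g)))

Σℚ-+ : ∀ {n} (f g : Fin n → ℚ) → Σℚ (λ i → f i + g i) ≡ Σℚ f + Σℚ g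
Σℚ-+ f g =
  trans (Σℚ≡sum (λ i → f i + g i))
    (trans (∑-distrib-+ f g) (sym (cong₂ _+_ (Σℚ≡sum f) (Σℚ≡sum g))))

Σℚ-*ˡ : ∀ {n} c (f : Fin n → ℚ) → Σℚ (λ i → c * f i) ≡ c * Σℚ f
Σℚ-*ˡ c f =
  trans (Σℚ≡sum (λ i → c * f i)) (sym (trans (cong (c *_) (Σℚ≡sum f)) (*-distribˡ-sum c f)))

Σℚ-zero : ∀ {n} {f : Fin n → ℚ} → (∀ i → f i ≡ 0ℚ) → Σℚ f ≡ 0ℚ
Σℚ-zero {n} f≗0 = trans (Σℚ-cong f≗0) (trans (Σℚ≡sum {n} (λ _ → 0ℚ)) (sum-replicate-zero n))

Σℚ-swap : ∀ {m n} (f : Fin m → Fin n → ℚ) →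
          Σℚ (λ i → Σℚ (λ j → f i j)) ≡ Σℚ (λ j → Σℚ (λ i → f i j))
Σℚ-swap f = trans (Σℚ²≡sum² f) (trans (∑-comm f) (sym (Σℚ²≡sum² (λ j i → f i j))))
  where
  Σℚ²≡sum² : ∀ {m n} (g : Fin m → Fin n → ℚ) → Σℚ (λ i → Σℚ (g i)) ≡ sum (λ i → sum (g i))
  Σℚ²≡sum² g = trans (Σℚ≡sum (λ i → Σℚ (g i))) (sum-cong-≗ (λ i → Σℚ≡sum (g i)))

Σℚ-neg : ∀ {n} (f : Fin n → ℚ) → Σℚ (λ i → - f i) ≡ - Σℚ f
Σℚ-neg {zero} f = refl
Σℚ-neg {suc n} f = trans (cong (- f F.zero +_) (Σℚ-neg (λ i → f (F.suc i))))
  (sym (ℚP.neg-distrib-+ (f F.zero) _))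

Σℚ-single : ∀ {n} (f : Fin n → ℚ) k → (∀ i → i ≢ k → f i ≡ 0ℚ) → Σℚ f ≡ f k
Σℚ-single f F.zero f≡0 =
  trans (cong (f F.zero +_) (Σℚ-zero (λ i → f≡0 (F.suc i) λ ()))) (ℚP.+-identityʳ _)
Σℚ-single f (F.suc k) f≡0 =
  trans (cong₂ _+_ (f≡0 F.zero λ ()) (Σℚ-single (λ i → f (F.suc i)) k
    (λ i i≢k → f≡0 (F.suc i) (i≢k ∘ FP.suc-injective)))) (ℚP.+-identityˡ _)

Σℚ-nonNeg : ∀ {n} (f : Fin n → ℚ) → (∀ i → 0ℚ ≤ f i) → 0ℚ ≤ Σℚ f
Σℚ-nonNeg {zero} f 0≤f = ℚP.≤-refl
Σℚ-nonNeg {suc n} f 0≤f =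
  ℚP.+-mono-≤ (0≤f F.zero) (Σℚ-nonNeg (λ i → f (F.suc i)) (λ i → 0≤f (F.suc i)))

δ-diag : ∀ {n} (i : Fin n) → δ i i ≡ 1ℚ
δ-diag i with i F.≟ i
... | yes _ = refl
... | no i≢i = ⊥-elim (i≢i refl)

δ-off-diag : ∀ {n} {i j : Fin n} → i ≢ j → δ i j ≡ 0ℚ
δ-off-diag {i = i} {j} i≢j with i F.≟ j
... | yes i≡j = ⊥-elim (i≢j i≡j)
... | no _ = refl

module _ {d : ℕ} where
  open Setoid (Fin d →-setoid ℚ) public
    using () renaming (refl to ≈V-refl; sym to ≈V-sym; trans to ≈V-trans; reflexive to ≡⇒≈V)

  -V≈-1· : ∀ (x : Vec d) → (-V x) ≈V ((- 1ℚ) ·V x)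
  -V≈-1· x k = trans (cong -_ (sym (ℚP.*-identityˡ (x k)))) (ℚP.neg-distribˡ-* 1ℚ (x k))

  lincomb-+ : ∀ {m} (a b : Fin m → ℚ) (v : Fin m → Vec d) →
              lincomb (λ j → a j + b j) v ≈V (lincomb a v +V lincomb b v)
  lincomb-+ a b v k =
    trans (Σℚ-cong (λ j → ℚP.*-distribʳ-+ (v j k) (a j) (b j)))
      (Σℚ-+ (λ j → a j * v j k) (λ j → b j * v j k))

  lincomb-zero : ∀ {m} (c : Fin m → ℚ) (v : Fin m → Vec d) → (∀ j → c j ≡ 0ℚ) → lincomb c v ≈V 0V
  lincomb-zero c v c≡0 k = Σℚ-zero (λ j → trans (cong (_* v j k) (c≡0 j)) (ℚP.*-zeroˡ (v j k)))

  lincomb-single : ∀ {m} (c : Fin m → ℚ) (v : Fin m → Vec d) i →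
                   (∀ j → j ≢ i → c j ≡ 0ℚ) → lincomb c v ≈V (c i ·V v i)
  lincomb-single c v i c≡0 k =
    Σℚ-single _ i (λ j j≢i → trans (cong (_* v j k) (c≡0 j j≢i)) (ℚP.*-zeroˡ (v j k)))

module ≈V-Reasoning {d : ℕ} = Relation.Binary.Reasoning.Setoid (Fin d →-setoid ℚ)

module Bilinear {d : ℕ} (G : Gram d) where
  open IP G

  G· : Vec d → Vec d
  G· y i = Σℚ (λ j → G i j * y j)

  ip≡Σ-G· : ∀ x y → ⟨ x , y ⟩ ≡ Σℚ (λ i → x i * G· y i)
  ip≡Σ-G· x y = Σℚ-cong (λ i → Σℚ-*ˡ (x i) (λ j → G i j * y j))

  ip-cong : ∀ {x x′ y y′} → x ≈V x′ → y ≈V y′ → ⟨ x , y ⟩ ≡ ⟨ x′ , y′ ⟩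
  ip-cong x≈ y≈ = Σℚ-cong (λ i → Σℚ-cong (λ j → cong₂ _*_ (x≈ i) (cong (G i j *_) (y≈ j))))

  ip-+ˡ : ∀ x y z → ⟨ x +V y , z ⟩ ≡ ⟨ x , z ⟩ + ⟨ y , z ⟩
  ip-+ˡ x y z = begin
    ⟨ x +V y , z ⟩
      ≡⟨ ip≡Σ-G· (x +V y) z ⟩
    Σℚ (λ i → (x i + y i) * G· z i)
      ≡⟨ Σℚ-cong (λ i → ℚP.*-distribʳ-+ (G· z i) (x i) (y i)) ⟩
    Σℚ (λ i → x i * G· z i + y i * G· z i)
      ≡⟨ Σℚ-+ (λ i → x i * G· z i) (λ i → y i * G· z i) ⟩
    Σℚ (λ i → x i * G· z i) + Σℚ (λ i → y i * G· z i)
      ≡⟨ cong₂ _+_ (ip≡Σ-G· x z) (ip≡Σ-G· y z) ⟨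
    ⟨ x , z ⟩ + ⟨ y , z ⟩
      ∎
    where open ≡-Reasoning

  ip-·ˡ : ∀ c x z → ⟨ c ·V x , z ⟩ ≡ c * ⟨ x , z ⟩
  ip-·ˡ c x z = begin
    ⟨ c ·V x , z ⟩                   ≡⟨ ip≡Σ-G· (c ·V x) z ⟩
    Σℚ (λ i → (c * x i) * G· z i)    ≡⟨ Σℚ-cong (λ i → ℚP.*-assoc c (x i) (G· z i)) ⟩
    Σℚ (λ i → c * (x i * G· z i))    ≡⟨ Σℚ-*ˡ c (λ i → x i * G· z i) ⟩
    c * Σℚ (λ i → x i * G· z i)      ≡⟨ cong (c *_) (ip≡Σ-G· x z) ⟨
    c * ⟨ x , z ⟩                    ∎
    where open ≡-Reasoning

  ip-negˡ : ∀ x z → ⟨ -V x , z ⟩ ≡ - ⟨ x , z ⟩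
  ip-negˡ x z = begin
    ⟨ -V x , z ⟩                   ≡⟨ ip≡Σ-G· (-V x) z ⟩
    Σℚ (λ i → (- x i) * G· z i)    ≡⟨ Σℚ-cong (λ i → ℚP.neg-distribˡ-* (x i) (G· z i)) ⟨
    Σℚ (λ i → - (x i * G· z i))    ≡⟨ Σℚ-neg (λ i → x i * G· z i) ⟩
    - Σℚ (λ i → x i * G· z i)      ≡⟨ cong -_ (ip≡Σ-G· x z) ⟨
    - ⟨ x , z ⟩                    ∎
    where open ≡-Reasoning

  ip-lincombˡ : ∀ {m} (c : Fin m → ℚ) (v : Fin m → Vec d) z →
                ⟨ lincomb c v , z ⟩ ≡ Σℚ (λ j → c j * ⟨ v j , z ⟩)
  ip-lincombˡ c v z = begin
    ⟨ lincomb c v , z ⟩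
      ≡⟨ ip≡Σ-G· (lincomb c v) z ⟩
    Σℚ (λ i → Σℚ (λ j → c j * v j i) * G· z i)
      ≡⟨ Σℚ-cong (λ i → Σℚ-*ʳ (G· z i) (λ j → c j * v j i)) ⟩
    Σℚ (λ i → Σℚ (λ j → (c j * v j i) * G· z i))
      ≡⟨ Σℚ-swap (λ i j → (c j * v j i) * G· z i) ⟩
    Σℚ (λ j → Σℚ (λ i → (c j * v j i) * G· z i))
      ≡⟨ Σℚ-cong (λ j → Σℚ-cong (λ i → ℚP.*-assoc (c j) (v j i) (G· z i))) ⟩
    Σℚ (λ j → Σℚ (λ i → c j * (v j i * G· z i)))
      ≡⟨ Σℚ-cong (λ j → trans (Σℚ-*ˡ (c j) (λ i → v j i * G· z i))
                              (cong (c j *_) (sym (ip≡Σ-G· (v j) z)))) ⟩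
    Σℚ (λ j → c j * ⟨ v j , z ⟩)
      ∎
    where
    open ≡-Reasoning
    Σℚ-*ʳ : ∀ {n} c (f : Fin n → ℚ) → Σℚ f * c ≡ Σℚ (λ i → f i * c)
    Σℚ-*ʳ c f =
      trans (ℚP.*-comm (Σℚ f) c) (trans (sym (Σℚ-*ˡ c f)) (Σℚ-cong (λ i → ℚP.*-comm c (f i))))

module Reflections {d : ℕ} (G : Gram d) (G-sym : ∀ i j → G i j ≡ G j i) where
  open IP G
  open Bilinear G public

  ip-sym : ∀ x y → ⟨ x , y ⟩ ≡ ⟨ y , x ⟩
  ip-sym x y = trans (Σℚ-cong (λ i → Σℚ-cong (λ j → swap i j)))
    (Σℚ-swap (λ i j → y j * (G j i * x i)))
    where
    swap : ∀ i j → x i * (G i j * y j) ≡ y j * (G j i * x i)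
    swap i j = trans (cong (λ g → x i * (g * y j)) (G-sym i j))
      (solve 3 (λ a g b → a :* (g :* b) := b :* (g :* a)) refl (x i) (G j i) (y j))

  ⟨_,_∨⟩ : Vec d → Vec d → ℚ
  ⟨ v , a ∨⟩ = ⟨ v , coroot a ⟩

  ∨-scale : Vec d → ℚ
  ∨-scale a = two ÷' ⟨ a , a ⟩

  pairing≡∨-scale*ip : ∀ v a → ⟨ v , a ∨⟩ ≡ ∨-scale a * ⟨ a , v ⟩
  pairing≡∨-scale*ip v a = trans (ip-sym v (coroot a)) (ip-·ˡ (∨-scale a) a v)

  pairing-cong : ∀ {x x′ a a′} → x ≈V x′ → a ≈V a′ → ⟨ x , a ∨⟩ ≡ ⟨ x′ , a′ ∨⟩
  pairing-cong x≈ a≈ = ip-cong x≈ (λ k → cong₂ _*_ (cong (two ÷'_) (ip-cong a≈ a≈)) (a≈ k))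

  pairing-self : ∀ a → ⟨ a , a ⟩ ≢ 0ℚ → ⟨ a , a ∨⟩ ≡ two
  pairing-self a aa≢0 = trans (pairing≡∨-scale*ip a a) (÷'-*-cancel two aa≢0)

  record IsLinearIsometry (f : Vec d → Vec d) : Set where
    field
      ≈-cong  : ∀ {x y} → x ≈V y → f x ≈V f y
      +-homo  : ∀ x y → f (x +V y) ≈V (f x +V f y)
      ·-homo  : ∀ c x → f (c ·V x) ≈V (c ·V f x)
      ip-homo : ∀ x y → ⟨ f x , f y ⟩ ≡ ⟨ x , y ⟩

    -‿homo : ∀ x → f (-V x) ≈V (-V f x)
    -‿homo x = ≈V-trans (≈-cong (-V≈-1· x)) (≈V-trans (·-homo (- 1ℚ) x) (≈V-sym (-V≈-1· (f x))))

    pairing-homo : ∀ x a → ⟨ f x , f a ∨⟩ ≡ ⟨ x , a ∨⟩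
    pairing-homo x a = begin
      ⟨ f x , f a ∨⟩                    ≡⟨ pairing≡∨-scale*ip (f x) (f a) ⟩
      ∨-scale (f a) * ⟨ f a , f x ⟩     ≡⟨ cong₂ (λ aa ax → (two ÷' aa) * ax) (ip-homo a a) (ip-homo a x) ⟩
      ∨-scale a * ⟨ a , x ⟩             ≡⟨ pairing≡∨-scale*ip x a ⟨
      ⟨ x , a ∨⟩                        ∎
      where open ≡-Reasoning

    refl'-conj : ∀ a x → f (refl' a x) ≈V refl' (f a) (f x)
    refl'-conj a x k = begin
      f (x +V (-V (⟨ x , a ∨⟩ ·V a))) k          ≡⟨ +-homo x _ k ⟩
      f x k + f (-V (⟨ x , a ∨⟩ ·V a)) k         ≡⟨ cong (f x k +_) (-‿homo _ k) ⟩
      f x k + - f (⟨ x , a ∨⟩ ·V a) k            ≡⟨ cong (λ y → f x k + - y) (·-homo ⟨ x , a ∨⟩ a k) ⟩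
      f x k + - (⟨ x , a ∨⟩ * f a k)             ≡⟨ cong (λ p → f x k + - (p * f a k)) (pairing-homo x a) ⟨
      f x k + - (⟨ f x , f a ∨⟩ * f a k)         ∎
      where open ≡-Reasoning

  id-isLinearIsometry : IsLinearIsometry (λ x → x)
  id-isLinearIsometry = record
    { ≈-cong = λ x≈y → x≈y
    ; +-homo = λ _ _ → ≈V-refl
    ; ·-homo = λ _ _ → ≈V-refl
    ; ip-homo = λ _ _ → refl
    }

  ∘-isLinearIsometry : ∀ {f g} → IsLinearIsometry f → IsLinearIsometry g →
                       IsLinearIsometry (λ x → g (f x))
  ∘-isLinearIsometry {f} {g} f-iso g-iso = record
    { ≈-cong = λ x≈y → Iᵍ.≈-cong (Iᶠ.≈-cong x≈y)
    ; +-homo = λ x y → ≈V-trans (Iᵍ.≈-cong (Iᶠ.+-homo x y)) (Iᵍ.+-homo (f x) (f y))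
    ; ·-homo = λ c x → ≈V-trans (Iᵍ.≈-cong (Iᶠ.·-homo c x)) (Iᵍ.·-homo c (f x))
    ; ip-homo = λ x y → trans (Iᵍ.ip-homo (f x) (f y)) (Iᶠ.ip-homo x y)
    }
    where
    module Iᶠ = IsLinearIsometry f-iso
    module Iᵍ = IsLinearIsometry g-iso

  refl'-cong : ∀ {a a′ x x′} → a ≈V a′ → x ≈V x′ → refl' a x ≈V refl' a′ x′
  refl'-cong a≈ x≈ k = cong₂ (λ y p → y + - p) (x≈ k) (cong₂ _*_ (pairing-cong x≈ a≈) (a≈ k))

  refl'-fix : ∀ {a x} → ⟨ x , a ∨⟩ ≡ 0ℚ → refl' a x ≈V x
  refl'-fix {a} {x} x⊥a k = trans (cong (λ p → x k + - (p * a k)) x⊥a)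
    (solve 2 (λ y b → y :+ :- (con 0ℚ :* b) := y) refl (x k) (a k))

  pairing-refl' : ∀ a x → ⟨ a , a ⟩ ≢ 0ℚ → ⟨ refl' a x , a ∨⟩ ≡ - ⟨ x , a ∨⟩
  pairing-refl' a x aa≢0 = begin
    ⟨ x +V (-V (p ·V a)) , a ∨⟩                  ≡⟨ ip-+ˡ x _ (coroot a) ⟩
    p + ⟨ -V (p ·V a) , a ∨⟩                      ≡⟨ cong (p +_) (ip-negˡ (p ·V a) (coroot a)) ⟩
    p + - ⟨ p ·V a , a ∨⟩                         ≡⟨ cong (λ q → p + - q) (ip-·ˡ p a (coroot a)) ⟩
    p + - (p * ⟨ a , a ∨⟩)                        ≡⟨ cong (λ q → p + - (p * q)) (pairing-self a aa≢0) ⟩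
    p + - (p * two)                               ≡⟨ solve 1 (λ q → q :+ :- (q :* (con 1ℚ :+ con 1ℚ)) := :- q)
                                                           refl p ⟩
    - p                                           ∎
    where
    open ≡-Reasoning
    p = ⟨ x , a ∨⟩

  refl'-involutive : ∀ a x → ⟨ a , a ⟩ ≢ 0ℚ → refl' a (refl' a x) ≈V x
  refl'-involutive a x aa≢0 k =
    trans (cong (λ q → (x k + - (⟨ x , a ∨⟩ * a k)) + - (q * a k)) (pairing-refl' a x aa≢0))
      (solve 3 (λ y p b → (y :+ :- (p :* b)) :+ :- ((:- p) :* b) := y) refl (x k) ⟨ x , a ∨⟩ (a k))

  refl'-self : ∀ a → ⟨ a , a ⟩ ≢ 0ℚ → refl' a a ≈V (-V a)
  refl'-self a aa≢0 k = trans (cong (λ p → a k + - (p * a k)) (pairing-self a aa≢0))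
    (solve 1 (λ b → b :+ :- ((con 1ℚ :+ con 1ℚ) :* b) := :- b) refl (a k))

  refl'-isLinearIsometry : ∀ a → ⟨ a , a ⟩ ≢ 0ℚ → IsLinearIsometry (refl' a)
  refl'-isLinearIsometry a aa≢0 = record
    { ≈-cong = refl'-cong ≈V-refl
    ; +-homo = +-homo
    ; ·-homo = ·-homo
    ; ip-homo = ip-homo
    }
    where
    +-homo : ∀ x y → refl' a (x +V y) ≈V (refl' a x +V refl' a y)
    +-homo x y k = trans (cong (λ p → (x k + y k) + - (p * a k)) (ip-+ˡ x y (coroot a)))
      (solve 5 (λ u v p q b → (u :+ v) :+ :- ((p :+ q) :* b) := (u :+ :- (p :* b)) :+ (v :+ :- (q :* b)))
        refl (x k) (y k) ⟨ x , a ∨⟩ ⟨ y , a ∨⟩ (a k))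
    ·-homo : ∀ c x → refl' a (c ·V x) ≈V (c ·V refl' a x)
    ·-homo c x k = trans (cong (λ p → (c * x k) + - (p * a k)) (ip-·ˡ c x (coroot a)))
      (solve 4 (λ c u p b → (c :* u) :+ :- ((c :* p) :* b) := c :* (u :+ :- (p :* b)))
        refl c (x k) ⟨ x , a ∨⟩ (a k))
    ip-reflˡ : ∀ x z → ⟨ refl' a x , z ⟩ ≡ ⟨ x , z ⟩ + - (⟨ x , a ∨⟩ * ⟨ a , z ⟩)
    ip-reflˡ x z = trans (ip-+ˡ x _ z) (cong (⟨ x , z ⟩ +_)
      (trans (ip-negˡ (⟨ x , a ∨⟩ ·V a) z) (cong -_ (ip-·ˡ ⟨ x , a ∨⟩ a z))))
    ip-homo : ∀ x y → ⟨ refl' a x , refl' a y ⟩ ≡ ⟨ x , y ⟩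
    ip-homo x y = begin
      ⟨ refl' a x , refl' a y ⟩
        ≡⟨ ip-reflˡ x (refl' a y) ⟩
      ⟨ x , refl' a y ⟩ + - (p * ⟨ a , refl' a y ⟩)
        ≡⟨ cong₂ (λ u v → u + - (p * v)) (trans (ip-sym x _) (ip-reflˡ y x))
                                          (trans (ip-sym a _) (ip-reflˡ y a)) ⟩
      (⟨ y , x ⟩ + - (q * A)) + - (p * (⟨ y , a ⟩ + - (q * N)))
        ≡⟨ cong (λ u → (⟨ y , x ⟩ + - (q * A)) + - (p * (u + - (q * N)))) (ip-sym y a) ⟩
      (⟨ y , x ⟩ + - (q * A)) + - (p * (B + - (q * N)))
        ≡⟨ cong₂ (λ p′ q′ → (⟨ y , x ⟩ + - (q′ * A)) + - (p′ * (B + - (q′ * N))))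
             (pairing≡∨-scale*ip x a) (pairing≡∨-scale*ip y a) ⟩
      (⟨ y , x ⟩ + - ((c * B) * A)) + - ((c * A) * (B + - ((c * B) * N)))
        ≡⟨ solve 6 (λ yx c A B N t →
                      (yx :+ :- ((c :* B) :* A)) :+ :- ((c :* A) :* (B :+ :- ((c :* B) :* N)))
                   := yx :+ (c :* A :* B) :* (c :* N :- t) :+ (c :* A :* B) :* (t :- (con 1ℚ :+ con 1ℚ)))
             refl ⟨ y , x ⟩ c A B N two ⟩
      ⟨ y , x ⟩ + (c * A * B) * (c * N - two) + (c * A * B) * (two - two)
        ≡⟨ cong (λ cN → ⟨ y , x ⟩ + (c * A * B) * (cN - two) + (c * A * B) * (two - two))
             (÷'-*-cancel two aa≢0) ⟩
      ⟨ y , x ⟩ + (c * A * B) * (two - two) + (c * A * B) * (two - two)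
        ≡⟨ solve 3 (λ yx m t → yx :+ m :* (t :- t) :+ m :* (t :- t) := yx) refl ⟨ y , x ⟩ (c * A * B) two ⟩
      ⟨ y , x ⟩
        ≡⟨ ip-sym y x ⟩
      ⟨ x , y ⟩ ∎
      where
      open ≡-Reasoning
      p = ⟨ x , a ∨⟩
      q = ⟨ y , a ∨⟩
      c = ∨-scale a
      A = ⟨ a , x ⟩
      B = ⟨ a , y ⟩
      N = ⟨ a , a ⟩

module Words {d : ℕ} (G : Gram d) (G-sym : ∀ i j → G i j ≡ G j i) (α ω : Fin d → Vec d)
  (α-anisotropic : ∀ i → IP.⟨_,_⟩ G (α i) (α i) ≢ 0ℚ) where
  open IP G
  open Weyl α ω
  open Reflections G G-sym public

  s-isLinearIsometry : ∀ i → IsLinearIsometry (s i)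
  s-isLinearIsometry i = refl'-isLinearIsometry (α i) (α-anisotropic i)

  s-involutive : ∀ i x → s i (s i x) ≈V x
  s-involutive i x = refl'-involutive (α i) x (α-anisotropic i)

  s-self : ∀ i → s i (α i) ≈V (-V α i)
  s-self i = refl'-self (α i) (α-anisotropic i)

  -- act⁻¹ t is actInv t computed by structural recursion: the first letter of t acts first.
  act⁻¹ : List (Fin d) → Vec d → Vec d
  act⁻¹ [] x = x
  act⁻¹ (j ∷ t) x = act⁻¹ t (s j x)

  act⁻¹-isLinearIsometry : ∀ t → IsLinearIsometry (act⁻¹ t)
  act⁻¹-isLinearIsometry [] = id-isLinearIsometry
  act⁻¹-isLinearIsometry (j ∷ t) = ∘-isLinearIsometry (s-isLinearIsometry j) (act⁻¹-isLinearIsometry t)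

  act-isLinearIsometry : ∀ u → IsLinearIsometry (act u)
  act-isLinearIsometry [] = id-isLinearIsometry
  act-isLinearIsometry (i ∷ u) = ∘-isLinearIsometry (act-isLinearIsometry u) (s-isLinearIsometry i)

  module Act⁻¹ (t : List (Fin d)) = IsLinearIsometry (act⁻¹-isLinearIsometry t)
  module Act (u : List (Fin d)) = IsLinearIsometry (act-isLinearIsometry u)

  act⁻¹-++ : ∀ p q x → act⁻¹ (p ++ q) x ≡ act⁻¹ q (act⁻¹ p x)
  act⁻¹-++ [] q x = refl
  act⁻¹-++ (j ∷ p) q x = act⁻¹-++ p q (s j x)

  act≡act⁻¹-reverse : ∀ u x → act u x ≡ act⁻¹ (reverse u) x
  act≡act⁻¹-reverse [] x = refl
  act≡act⁻¹-reverse (i ∷ u) x = begin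
    s i (act u x)                        ≡⟨ cong (s i) (act≡act⁻¹-reverse u x) ⟩
    s i (act⁻¹ (reverse u) x)            ≡⟨ act⁻¹-++ (reverse u) (i ∷ []) x ⟨
    act⁻¹ (reverse u ++ i ∷ []) x        ≡⟨ cong (λ t → act⁻¹ t x) (ListP.unfold-reverse i u) ⟨
    act⁻¹ (reverse (i ∷ u)) x            ∎
    where open ≡-Reasoning

  actInv≡act⁻¹ : ∀ u x → actInv u x ≡ act⁻¹ u x
  actInv≡act⁻¹ u x =
    trans (act≡act⁻¹-reverse (reverse u) x) (cong (λ t → act⁻¹ t x) (ListP.reverse-involutive u))

  act⁻¹-act : ∀ t x → act⁻¹ t (act t x) ≈V x
  act⁻¹-act [] x = ≈V-refl
  act⁻¹-act (j ∷ t) x = ≈V-trans (Act⁻¹.≈-cong t (s-involutive j (act t x))) (act⁻¹-act t x)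

  act-act⁻¹ : ∀ t x → act t (act⁻¹ t x) ≈V x
  act-act⁻¹ [] x = ≈V-refl
  act-act⁻¹ (j ∷ t) x = ≈V-trans (refl'-cong ≈V-refl (act-act⁻¹ t (s j x))) (s-involutive j x)

  act⁻¹-agree⇒act-agree : ∀ t t′ → (∀ y → act⁻¹ t y ≈V act⁻¹ t′ y) →
                          ∀ x → act t x ≈V act t′ x
  act⁻¹-agree⇒act-agree t t′ t≗t′ x = ≈V-trans (≈V-sym (act-act⁻¹ t′ (act t x)))
    (Act.≈-cong t′ (≈V-trans (≈V-sym (t≗t′ (act t x))) (act⁻¹-act t x)))

module RootSystem {d : ℕ} {G : Gram d} {Φ : List (Vec d)} {α ω : Fin d → Vec d}
  (RS : IP.IsRootSystem G Φ) (B : IP.IsBase G Φ α) where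
  open IP G
  open IsRootSystem RS
  open IsBase B
  open Weyl α ω

  root-anisotropic : ∀ {β} → β ∈L Φ → 0ℚ < ⟨ β , β ⟩
  root-anisotropic β∈Φ = proj₂ innerProduct _ (nonzero _ β∈Φ)

  open Words G (proj₁ innerProduct) α ω
    (λ i αα≡0 → ℚP.<-irrefl (sym αα≡0) (root-anisotropic (simpleRoots i))) public

  ∈Φ-resp-≈ : ∀ {β β′} → β ∈L Φ → β ≈V β′ → β′ ∈L Φ
  ∈Φ-resp-≈ β∈Φ β≈β′ = Any.map (λ γ≈β → ≈V-trans γ≈β β≈β′) β∈Φ

  act⁻¹-∈Φ : ∀ t {β} → β ∈L Φ → act⁻¹ t β ∈L Φ
  act⁻¹-∈Φ [] β∈Φ = β∈Φ
  act⁻¹-∈Φ (j ∷ t) β∈Φ = act⁻¹-∈Φ t (reflClosed (α j) _ (simpleRoots j) β∈Φ)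

  IsPositive IsNegative : Vec d → Set
  IsPositive β = Σ (Fin d → ℕ) λ c → β ≈V lincomb (λ i → ℕ→ℚ (c i)) α
  IsNegative β = Σ (Fin d → ℕ) λ c → β ≈V (-V lincomb (λ i → ℕ→ℚ (c i)) α)

  positive⊎negative : ∀ {β} → β ∈L Φ → IsPositive β ⊎ IsNegative β
  positive⊎negative β∈Φ with signed _ β∈Φ
  ... | c , inj₁ β≈ = inj₁ (c , β≈)
  ... | c , inj₂ β≈ = inj₂ (c , β≈)

  ¬positive×negative : ∀ {β} → β ∈L Φ → IsPositive β → IsNegative β → ⊥
  ¬positive×negative {β} β∈Φ (c , β≈) (c′ , β≈′) =
    nonzero β β∈Φ (≈V-trans β≈ (lincomb-zero C α C≡0))
    where
    C C′ : Fin d → ℚ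
    C i = ℕ→ℚ (c i)
    C′ i = ℕ→ℚ (c′ i)
    C+C′≈0 : lincomb (λ i → C i + C′ i) α ≈V 0V
    C+C′≈0 k = begin
      lincomb (λ i → C i + C′ i) α k       ≡⟨ lincomb-+ C C′ α k ⟩
      lincomb C α k + lincomb C′ α k       ≡⟨ cong₂ _+_ (β≈ k) (neg-involutive _) ⟨
      β k + - (- lincomb C′ α k)           ≡⟨ cong (λ x → β k + - x) (β≈′ k) ⟨
      β k + - β k                          ≡⟨ ℚP.+-inverseʳ (β k) ⟩
      0ℚ                                   ∎
      where open ≡-Reasoning
    C≡0 : ∀ i → C i ≡ 0ℚ
    C≡0 i = ℕ→ℚ-sum≡0 (c i) (c′ i) (linIndep (λ i → C i + C′ i) C+C′≈0 i)

  negate-positive : ∀ {β β′} → IsPositive β → β′ ≈V (-V β) → IsNegative β′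
  negate-positive (c , β≈) β′≈ = c , λ k → trans (β′≈ k) (cong -_ (β≈ k))

  simple-positive : ∀ j → IsPositive (α j)
  simple-positive j = unit , ≈V-sym (≈V-trans (lincomb-single (λ i → ℕ→ℚ (unit i)) α j unit-off) unit-on)
    where
    unit : Fin d → ℕ
    unit i with i F.≟ j
    ... | yes _ = 1
    ... | no _ = 0
    unit-off : ∀ i → i ≢ j → ℕ→ℚ (unit i) ≡ 0ℚ
    unit-off i i≢j with i F.≟ j
    ... | yes i≡j = ⊥-elim (i≢j i≡j)
    ... | no _ = refl
    unit-on : (ℕ→ℚ (unit j) ·V α j) ≈V α j
    unit-on k with j F.≟ j
    ... | yes _ = ℚP.*-identityˡ (α j k)
    ... | no j≢j = ⊥-elim (j≢j refl)

  root-multiple-of-simple : ∀ {β n i} → β ∈L Φ → β ≈V (ℕ→ℚ n ·V α i) → β ≈V α i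
  root-multiple-of-simple {β} {n} {i} β∈Φ β≈
    with reduced (α i) (ℕ→ℚ n) (simpleRoots i) (∈Φ-resp-≈ β∈Φ β≈)
  ... | inj₁ n≡1 = λ k → trans (β≈ k) (trans (cong (_* α i k) n≡1) (ℚP.*-identityˡ (α i k)))
  ... | inj₂ n≡-1 = ⊥-elim (ℕ→ℚ≢-1 n n≡-1)

  -- β − s i β = ⟨ β , α i ∨⟩ α i, so by linear independence the coefficients of β vanish off i.
  positive-with-negative-reflection⇒simple : ∀ {β i} → β ∈L Φ → IsPositive β → IsNegative (s i β) →
                                             β ≈V α i
  positive-with-negative-reflection⇒simple {β} {i} β∈Φ (c , β≈) (c′ , sβ≈) =
    root-multiple-of-simple {n = c i} β∈Φ (≈V-trans β≈ (lincomb-single C α i C-off))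
    where
    p = ⟨ β , α i ∨⟩
    C C′ coef : Fin d → ℚ
    C j = ℕ→ℚ (c j)
    C′ j = ℕ→ℚ (c′ j)
    coef j = (C j + C′ j) + - (p * δ j i)
    coef≈0 : lincomb coef α ≈V 0V
    coef≈0 k = begin
      lincomb coef α k
        ≡⟨ lincomb-+ (λ j → C j + C′ j) (λ j → - (p * δ j i)) α k ⟩
      lincomb (λ j → C j + C′ j) α k + lincomb (λ j → - (p * δ j i)) α k
        ≡⟨ cong₂ _+_ (lincomb-+ C C′ α k) (lincomb-single (λ j → - (p * δ j i)) α i
             (λ j j≢i → trans (cong (λ x → - (p * x)) (δ-off-diag j≢i)) (cong -_ (ℚP.*-zeroʳ p))) k) ⟩
      (lincomb C α k + lincomb C′ α k) + - (p * δ i i) * α i k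
        ≡⟨ cong₂ (λ x y → (x + lincomb C′ α k) + - (p * y) * α i k) (β≈ k) (sym (δ-diag i)) ⟨
      (β k + lincomb C′ α k) + - (p * 1ℚ) * α i k
        ≡⟨ cong (λ x → (β k + x) + - (p * 1ℚ) * α i k)
             (trans (sym (neg-involutive _)) (cong -_ (sym (sβ≈ k)))) ⟩
      (β k + - (β k + - (p * α i k))) + - (p * 1ℚ) * α i k
        ≡⟨ solve 3 (λ b q a → (b :+ :- (b :+ :- (q :* a))) :+ :- (q :* con 1ℚ) :* a := con 0ℚ)
             refl (β k) p (α i k) ⟩
      0ℚ ∎
      where open ≡-Reasoning
    C-off : ∀ j → j ≢ i → C j ≡ 0ℚ
    C-off j j≢i = ℕ→ℚ-sum≡0 (c j) (c′ j) (trans coef≡ (linIndep coef coef≈0 j))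
      where
      coef≡ : C j + C′ j ≡ coef j
      coef≡ = sym (trans (cong (λ x → (C j + C′ j) + - (p * x)) (δ-off-diag j≢i))
        (solve 2 (λ x q → x :+ :- (q :* con 0ℚ) := x) refl (C j + C′ j) p))

  s-positive : ∀ {β} i → β ∈L Φ → IsPositive β → ¬ β ≈V α i → IsPositive (s i β)
  s-positive {β} i β∈Φ β⁺ β≉αi with positive⊎negative (reflClosed (α i) β (simpleRoots i) β∈Φ)
  ... | inj₁ sβ⁺ = sβ⁺
  ... | inj₂ sβ⁻ = ⊥-elim (β≉αi (positive-with-negative-reflection⇒simple β∈Φ β⁺ sβ⁻))

  record Crossing (t : List (Fin d)) (β : Vec d) : Set where
    field
      prefix  : List (Fin d)
      letter  : Fin d
      suffix  : List (Fin d)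
      split   : t ≡ prefix ++ letter ∷ suffix
      reaches : act⁻¹ prefix β ≈V α letter

  crossing : ∀ t {β} → β ∈L Φ → IsPositive β → IsNegative (act⁻¹ t β) → Crossing t β
  crossing [] β∈Φ β⁺ β⁻ = ⊥-elim (¬positive×negative β∈Φ β⁺ β⁻)
  crossing (j ∷ t) {β} β∈Φ β⁺ tβ⁻ with FP.all? (λ k → β k ≟ α j k)
  ... | yes β≈αj = record { prefix = [] ; letter = j ; suffix = t ; split = refl ; reaches = β≈αj }
  ... | no β≉αj =
    extend (crossing t (reflClosed (α j) β (simpleRoots j) β∈Φ) (s-positive j β∈Φ β⁺ β≉αj) tβ⁻)
    where
    extend : Crossing t (s j β) → Crossing (j ∷ t) β
    extend c = record
      { prefix = j ∷ prefix ; letter = letter ; suffix = suffix ; split = cong (j ∷_) split ; reaches = reaches }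
      where open Crossing c

  record Deletion (t : List (Fin d)) (j : Fin d) : Set where
    field
      word    : List (Fin d)
      shorter : suc (length word) ≡ length t
      factor  : ∀ x → act⁻¹ t x ≈V act⁻¹ word (s j x)

    cancels : ∀ x → act⁻¹ (j ∷ t) x ≈V act⁻¹ word x
    cancels x = ≈V-trans (factor (s j x)) (Act⁻¹.≈-cong word (s-involutive j x))

  negative-image⇒deletion : ∀ t j → IsNegative (act⁻¹ t (α j)) → Deletion t j
  negative-image⇒deletion t j tαj⁻ with crossing t (simpleRoots j) (simple-positive j) tαj⁻
  ... | record { prefix = p ; letter = i ; suffix = q ; split = refl ; reaches = pαj≈αi } = record
    { word = p ++ q ; shorter = sym (ListP.length-++-sucʳ p i q) ; factor = factor }
    where
    open ≈V-Reasoning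
    factor : ∀ x → act⁻¹ (p ++ i ∷ q) x ≈V act⁻¹ (p ++ q) (s j x)
    factor x = begin
      act⁻¹ (p ++ i ∷ q) x
        ≡⟨ act⁻¹-++ p (i ∷ q) x ⟩
      act⁻¹ q (refl' (α i) (act⁻¹ p x))
        ≈⟨ Act⁻¹.≈-cong q (refl'-cong {x = act⁻¹ p x} (≈V-sym pαj≈αi) ≈V-refl) ⟩
      act⁻¹ q (refl' (act⁻¹ p (α j)) (act⁻¹ p x))
        ≈⟨ Act⁻¹.≈-cong q (Act⁻¹.refl'-conj p (α j) x) ⟨
      act⁻¹ q (act⁻¹ p (s j x))
        ≡⟨ act⁻¹-++ p q (s j x) ⟨
      act⁻¹ (p ++ q) (s j x)
        ∎

  positive-image⇒deletion : ∀ t j → IsPositive (act⁻¹ (j ∷ t) (α j)) → Deletion t j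
  positive-image⇒deletion t j jtαj⁺ = negative-image⇒deletion t j (negate-positive jtαj⁺ tαj≈)
    where
    tαj≈ : act⁻¹ t (α j) ≈V (-V act⁻¹ t (s j (α j)))
    tαj≈ k = trans (sym (neg-involutive _)) (cong -_ (sym
      (≈V-trans (Act⁻¹.≈-cong t (s-self j)) (Act⁻¹.-‿homo t (α j)) k)))

  Dominant-resp-≈ : ∀ {x y} → Dominant x → x ≈V y → Dominant y
  Dominant-resp-≈ (n , x≈) x≈y = n , ≈V-trans (≈V-sym x≈y) x≈

  lincomb-ℕ-+ : ∀ (n m : Fin d → ℕ) → lincomb (λ i → ℕ→ℚ (n i +ℕ m i)) ω ≈V
                (lincomb (λ i → ℕ→ℚ (n i)) ω +V lincomb (λ i → ℕ→ℚ (m i)) ω)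
  lincomb-ℕ-+ n m k = trans (Σℚ-cong (λ i → cong (_* ω i k) (ℕ→ℚ-+ (n i) (m i))))
    (lincomb-+ (λ i → ℕ→ℚ (n i)) (λ i → ℕ→ℚ (m i)) ω k)

  Dominant-+ : ∀ {x y} → Dominant x → Dominant y → Dominant (x +V y)
  Dominant-+ (n , x≈) (m , y≈) =
    (λ i → n i +ℕ m i) , λ k → trans (cong₂ _+_ (x≈ k) (y≈ k)) (sym (lincomb-ℕ-+ n m k))

  ρ-dominant : ∀ k → Dominant (ρ k)
  ρ-dominant k = (λ i → k (α i)) , ≈V-refl

  ρ-⊕ : ∀ k m → ρ (k ⊕ m) ≈V (ρ k +V ρ m)
  ρ-⊕ k m = lincomb-ℕ-+ (λ i → k (α i)) (λ i → m (α i))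

  record IsMinimal (l : Vec d) (u : List (Fin d)) : Set where
    field
      dominant : Dominant (act⁻¹ u l)
      shortest : ∀ u′ → Dominant (act⁻¹ u′ l) → length u ≤ℕ length u′

  IsMinWord⇒IsMinimal : ∀ {l u} → IsMinWord l u → IsMinimal l u
  IsMinWord⇒IsMinimal {l} {u} (ul⁺ , min) = record
    { dominant = Dominant-resp-≈ ul⁺ (≡⇒≈V (actInv≡act⁻¹ u l))
    ; shortest = λ u′ u′l⁺ → min u′ (Dominant-resp-≈ u′l⁺ (≡⇒≈V (sym (actInv≡act⁻¹ u′ l))))
    }

  IsMinimal-resp-≈ : ∀ {l l′ u} → l ≈V l′ → IsMinimal l u → IsMinimal l′ u
  IsMinimal-resp-≈ {u = u} l≈l′ min = record
    { dominant = Dominant-resp-≈ dominant (Act⁻¹.≈-cong u l≈l′)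
    ; shortest = λ u′ u′l′⁺ →
        shortest u′ (Dominant-resp-≈ u′l′⁺ (Act⁻¹.≈-cong u′ (≈V-sym l≈l′)))
    }
    where open IsMinimal min

  minimal-tail : ∀ {l i v} → IsMinimal l (i ∷ v) → IsMinimal (s i l) v
  minimal-tail {i = i} min = record
    { dominant = dominant ; shortest = λ v′ v′⁺ → ℕP.≤-pred (shortest (i ∷ v′) v′⁺) }
    where open IsMinimal min

  module _ (FW : IsFundWeights α ω) where

    dominant-pairing-nonNeg : ∀ {Y} → Dominant Y → ∀ j → 0ℚ ≤ ⟨ Y , α j ∨⟩
    dominant-pairing-nonNeg {Y} (n , Y≈) j = subst (0ℚ ≤_) (sym Yαj≡nj) (ℕ→ℚ-nonNeg (n j))
      where
      open ≡-Reasoning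
      N : Fin d → ℚ
      N i = ℕ→ℚ (n i)
      Yαj≡nj : ⟨ Y , α j ∨⟩ ≡ N j
      Yαj≡nj = begin
        ⟨ Y , α j ∨⟩
          ≡⟨ ip-cong Y≈ ≈V-refl ⟩
        ⟨ lincomb N ω , coroot (α j) ⟩
          ≡⟨ ip-lincombˡ N ω (coroot (α j)) ⟩
        Σℚ (λ i → N i * ⟨ ω i , coroot (α j) ⟩)
          ≡⟨ Σℚ-cong (λ i → cong (N i *_) (FW i j)) ⟩
        Σℚ (λ i → N i * δ i j)
          ≡⟨ Σℚ-single (λ i → N i * δ i j) j
               (λ i i≢j → trans (cong (N i *_) (δ-off-diag i≢j)) (ℚP.*-zeroʳ (N i))) ⟩
        N j * δ j j
          ≡⟨ cong (N j *_) (δ-diag j) ⟩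
        N j * 1ℚ
          ≡⟨ ℚP.*-identityʳ (N j) ⟩
        N j
          ∎

    ∨-scale-pos : ∀ {β} → β ∈L Φ → 0ℚ < ∨-scale β
    ∨-scale-pos β∈Φ = ÷'-pos (ℚP.positive⁻¹ two) (root-anisotropic β∈Φ)

    dominant-ip-positive-nonNeg : ∀ {Y} → Dominant Y → (c : Fin d → ℕ) →
                                  0ℚ ≤ ⟨ lincomb (λ i → ℕ→ℚ (c i)) α , Y ⟩
    dominant-ip-positive-nonNeg {Y} Y⁺ c =
      subst (0ℚ ≤_) (sym (ip-lincombˡ (λ i → ℕ→ℚ (c i)) α Y))
        (Σℚ-nonNeg (λ i → ℕ→ℚ (c i) * ⟨ α i , Y ⟩)
          (λ i → nonNeg*nonNeg (ℕ→ℚ-nonNeg (c i)) (ip-simple-nonNeg i)))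
      where
      ip-simple-nonNeg : ∀ i → 0ℚ ≤ ⟨ α i , Y ⟩
      ip-simple-nonNeg i = pos*-nonNeg⁻¹ (∨-scale-pos (simpleRoots i))
        (subst (0ℚ ≤_) (pairing≡∨-scale*ip Y (α i)) (dominant-pairing-nonNeg Y⁺ i))

    positive-root-pairing-nonNeg : ∀ {Y β} → Dominant Y → β ∈L Φ → IsPositive β → 0ℚ ≤ ⟨ Y , β ∨⟩
    positive-root-pairing-nonNeg {Y} {β} Y⁺ β∈Φ (c , β≈) =
      subst (0ℚ ≤_) (sym (pairing≡∨-scale*ip Y β))
        (nonNeg*nonNeg (ℚP.<⇒≤ (∨-scale-pos β∈Φ))
          (subst (0ℚ ≤_) (ip-cong (≈V-sym β≈) ≈V-refl) (dominant-ip-positive-nonNeg Y⁺ c)))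

    negative-root-pairing-nonPos : ∀ {Y β} → Dominant Y → β ∈L Φ → IsNegative β → ⟨ Y , β ∨⟩ ≤ 0ℚ
    negative-root-pairing-nonPos {Y} {β} Y⁺ β∈Φ (c , β≈) =
      subst (_≤ 0ℚ) (sym (pairing≡∨-scale*ip Y β))
        (pos*nonPos (∨-scale-pos β∈Φ)
          (subst (_≤ 0ℚ)
            (trans (sym (ip-negˡ (lincomb (λ i → ℕ→ℚ (c i)) α) Y)) (ip-cong (≈V-sym β≈) ≈V-refl))
            (ℚP.neg-antimono-≤ (dominant-ip-positive-nonNeg Y⁺ c))))

    -- If act⁻¹ (j ∷ t) (α j) is negative, dominance of the image forces ⟨ D , α j ∨⟩ = ⟨ E , α j ∨⟩ = 0,
    -- so s j fixes D and D + E; otherwise j ∷ t acts as a strictly shorter word.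
    stabiliser : ∀ t {D E} → Dominant D → Dominant E → Dominant (act⁻¹ t (D +V E)) → act⁻¹ t D ≈V D
    stabiliser t = bounded t ℕP.≤-refl
      where
      bounded : ∀ {n} t {D E} → length t ≤ℕ n →
                Dominant D → Dominant E → Dominant (act⁻¹ t (D +V E)) → act⁻¹ t D ≈V D
      bounded [] _ _ _ _ = ≈V-refl
      bounded {suc n} (j ∷ t) {D} {E} (s≤s |t|≤n) D⁺ E⁺ tDE⁺
        with positive⊎negative (act⁻¹-∈Φ (j ∷ t) (simpleRoots j))
      ... | inj₁ jtαj⁺ =
        ≈V-trans (cancels D) (bounded word |word|≤n D⁺ E⁺ (Dominant-resp-≈ tDE⁺ (cancels (D +V E))))
        where
        open Deletion (positive-image⇒deletion t j jtαj⁺)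
        |word|≤n : length word ≤ℕ n
        |word|≤n = ℕP.≤-trans (ℕP.n≤1+n _) (subst (_≤ℕ n) (sym shorter) |t|≤n)
      ... | inj₂ jtαj⁻ =
        ≈V-trans (Act⁻¹.≈-cong t (refl'-fix D⊥αj))
          (bounded t |t|≤n D⁺ E⁺ (Dominant-resp-≈ tDE⁺ (Act⁻¹.≈-cong t (refl'-fix DE⊥αj))))
        where
        sum≤0 : ⟨ D , α j ∨⟩ + ⟨ E , α j ∨⟩ ≤ 0ℚ
        sum≤0 = subst (_≤ 0ℚ)
          (trans (Act⁻¹.pairing-homo (j ∷ t) (D +V E) (α j)) (ip-+ˡ D E (coroot (α j))))
          (negative-root-pairing-nonPos tDE⁺ (act⁻¹-∈Φ (j ∷ t) (simpleRoots j)) jtαj⁻)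
        D⊥αj : ⟨ D , α j ∨⟩ ≡ 0ℚ
        D⊥αj = p+q≤0⇒p≡0 (dominant-pairing-nonNeg D⁺ j) (dominant-pairing-nonNeg E⁺ j) sum≤0
        E⊥αj : ⟨ E , α j ∨⟩ ≡ 0ℚ
        E⊥αj = p+q≤0⇒p≡0 (dominant-pairing-nonNeg E⁺ j) (dominant-pairing-nonNeg D⁺ j)
          (subst (_≤ 0ℚ) (ℚP.+-comm ⟨ D , α j ∨⟩ ⟨ E , α j ∨⟩) sum≤0)
        DE⊥αj : ⟨ D +V E , α j ∨⟩ ≡ 0ℚ
        DE⊥αj = trans (ip-+ˡ D E (coroot (α j))) (trans (cong₂ _+_ D⊥αj E⊥αj) (ℚP.+-identityʳ 0ℚ))

    IsMinimal-+act : ∀ {l u E} → IsMinimal l u → Dominant E → IsMinimal (l +V act u E) u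
    IsMinimal-+act {l} {u} {E} min E⁺ = record
      { dominant = Dominant-resp-≈ (Dominant-+ dominant E⁺) (≈V-sym u[l+uE]≈D+E)
      ; shortest = shortest′
      }
      where
      open IsMinimal min
      D : Vec d
      D = act⁻¹ u l
      u[l+uE]≈D+E : act⁻¹ u (l +V act u E) ≈V (D +V E)
      u[l+uE]≈D+E = ≈V-trans (Act⁻¹.+-homo u l (act u E)) (λ k → cong (D k +_) (act⁻¹-act u E k))
      l+uE≈u[D+E] : (l +V act u E) ≈V act u (D +V E)
      l+uE≈u[D+E] = ≈V-sym (≈V-trans (Act.+-homo u D E) (λ k → cong (_+ act u E k) (act-act⁻¹ u l k)))
      -- The word reverse u ++ u′ acts as u′ after u, so the stabiliser lemma applies to it.
      shortest′ : ∀ u′ → Dominant (act⁻¹ u′ (l +V act u E)) → length u ≤ℕ length u′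
      shortest′ u′ u′⁺ = shortest u′ (Dominant-resp-≈ dominant (≈V-sym u′l≈D))
        where
        t = reverse u ++ u′
        t≈u′∘u : ∀ x → act⁻¹ t x ≈V act⁻¹ u′ (act u x)
        t≈u′∘u x =
          ≡⇒≈V (trans (act⁻¹-++ (reverse u) u′ x) (cong (act⁻¹ u′) (sym (act≡act⁻¹-reverse u x))))
        tD≈D : act⁻¹ t D ≈V D
        tD≈D = stabiliser t dominant E⁺
          (Dominant-resp-≈ u′⁺
            (≈V-sym (≈V-trans (t≈u′∘u (D +V E)) (Act⁻¹.≈-cong u′ (≈V-sym l+uE≈u[D+E])))))
        u′l≈D : act⁻¹ u′ l ≈V D
        u′l≈D =
          ≈V-trans (Act⁻¹.≈-cong u′ (≈V-sym (act-act⁻¹ u l))) (≈V-trans (≈V-sym (t≈u′∘u D)) tD≈D)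

    minimal-descent : ∀ {l i v} → IsMinimal l (i ∷ v) → ⟨ l , α i ∨⟩ < 0ℚ
    minimal-descent {l} {i} {v} min with positive⊎negative (act⁻¹-∈Φ (i ∷ v) (simpleRoots i))
    ... | inj₁ ivαi⁺ = ⊥-elim (ℕP.1+n≰n (ℕP.≤-trans (ℕP.n≤1+n _) 2+|word|≤|word|))
      where
      open IsMinimal min
      open Deletion (positive-image⇒deletion v i ivαi⁺)
      2+|word|≤|word| : suc (suc (length word)) ≤ℕ length word
      2+|word|≤|word| = subst (_≤ℕ length word) (cong suc (sym shorter))
        (shortest word (Dominant-resp-≈ dominant (cancels l)))
    ... | inj₂ ivαi⁻ = ≤0∧≢0⇒<0 l·αi≤0 l·αi≢0
      where
      open IsMinimal min
      l·αi≤0 : ⟨ l , α i ∨⟩ ≤ 0ℚ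
      l·αi≤0 = subst (_≤ 0ℚ) (Act⁻¹.pairing-homo (i ∷ v) l (α i))
        (negative-root-pairing-nonPos dominant (act⁻¹-∈Φ (i ∷ v) (simpleRoots i)) ivαi⁻)
      l·αi≢0 : ⟨ l , α i ∨⟩ ≢ 0ℚ
      l·αi≢0 l⊥αi =
        ℕP.1+n≰n (shortest v (Dominant-resp-≈ dominant (Act⁻¹.≈-cong v (refl'-fix l⊥αi))))

    descent⇒deletion : ∀ {l i u} → Dominant (act⁻¹ u l) → ⟨ l , α i ∨⟩ < 0ℚ → Deletion u i
    descent⇒deletion {l} {i} {u} ul⁺ l·αi<0 with positive⊎negative (act⁻¹-∈Φ u (simpleRoots i))
    ... | inj₁ uαi⁺ = ⊥-elim (ℚP.<-irrefl refl (ℚP.<-≤-trans l·αi<0 0≤l·αi))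
      where
      0≤l·αi : 0ℚ ≤ ⟨ l , α i ∨⟩
      0≤l·αi = subst (0ℚ ≤_) (Act⁻¹.pairing-homo u l (α i))
        (positive-root-pairing-nonNeg ul⁺ (act⁻¹-∈Φ u (simpleRoots i)) uαi⁺)
    ... | inj₂ uαi⁻ = negative-image⇒deletion u i uαi⁻

    minimal-words-agree : ∀ {l} u u′ → IsMinimal l u → IsMinimal l u′ → ∀ x → act u x ≈V act u′ x
    minimal-words-agree [] [] _ _ x = ≈V-refl
    minimal-words-agree [] (_ ∷ _) min min′ x with IsMinimal.shortest min′ [] (IsMinimal.dominant min)
    ... | ()
    minimal-words-agree {l} (i ∷ v) u′ min min′ x = begin
      s i (act v x)       ≈⟨ refl'-cong ≈V-refl (minimal-words-agree v word (minimal-tail min) word-minimal x) ⟩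
      s i (act word x)    ≈⟨ act⁻¹-agree⇒act-agree (i ∷ word) u′ (λ y → ≈V-sym (factor y)) x ⟩
      act u′ x            ∎
      where
      open ≈V-Reasoning
      open Deletion (descent⇒deletion {l} {i} {u′} (IsMinimal.dominant min′) (minimal-descent min))
      |u′|≡1+|v| : length u′ ≡ suc (length v)
      |u′|≡1+|v| = ℕP.≤-antisym (IsMinimal.shortest min′ (i ∷ v) (IsMinimal.dominant min))
                                (IsMinimal.shortest min u′ (IsMinimal.dominant min′))
      |v|≡|word| : length v ≡ length word
      |v|≡|word| = ℕP.suc-injective (trans (sym |u′|≡1+|v|) (sym shorter))
      word-minimal : IsMinimal (s i l) word
      word-minimal = record
        { dominant = Dominant-resp-≈ (IsMinimal.dominant min′) (factor l)
        ; shortest = λ v′ v′⁺ →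
            subst (_≤ℕ length v′) |v|≡|word| (IsMinimal.shortest (minimal-tail min) v′ v′⁺)
        }

    image-minimal : ∀ k {l μ u} → IsMinWord l u → μ ≈V (l +V act u (ρ k)) → IsMinimal μ u
    image-minimal k l-min μ≈ =
      IsMinimal-resp-≈ (≈V-sym μ≈) (IsMinimal-+act (IsMinWord⇒IsMinimal l-min) (ρ-dominant k))

    η-compose : ∀ k m {l μ ν ν′} → Eta k l μ → Eta m μ ν → Eta (k ⊕ m) l ν′ → ν ≈V ν′
    η-compose k m {l} {μ} {ν} {ν′} (u , u-min , μ≈) (u′ , u′-min , ν≈) (u″ , u″-min , ν′≈) i =
      begin
      ν i                                            ≡⟨ ν≈ i ⟩
      μ i + act u′ (ρ m) i                           ≡⟨ cong₂ _+_ (μ≈ i) (u′≗u (ρ m) i) ⟩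
      (l i + act u (ρ k) i) + act u (ρ m) i          ≡⟨ ℚP.+-assoc (l i) _ _ ⟩
      l i + (act u (ρ k) i + act u (ρ m) i)          ≡⟨ cong (l i +_) (Act.+-homo u (ρ k) (ρ m) i) ⟨
      l i + act u (ρ k +V ρ m) i                     ≡⟨ cong (l i +_) (Act.≈-cong u (ρ-⊕ k m) i) ⟨
      l i + act u (ρ (k ⊕ m)) i                      ≡⟨ cong (l i +_) (u≗u″ (ρ (k ⊕ m)) i) ⟩
      l i + act u″ (ρ (k ⊕ m)) i                     ≡⟨ ν′≈ i ⟨
      ν′ i                                           ∎
      where
      open ≡-Reasoning
      u′≗u : ∀ x → act u′ x ≈V act u x
      u′≗u = minimal-words-agree u′ u (IsMinWord⇒IsMinimal u′-min) (image-minimal k u-min μ≈)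
      u≗u″ : ∀ x → act u x ≈V act u″ x
      u≗u″ = minimal-words-agree u u″ (IsMinWord⇒IsMinimal u-min) (IsMinWord⇒IsMinimal u″-min)

    η-injective : ∀ k {l l′ μ} → Eta k l μ → Eta k l′ μ → l ≈V l′
    η-injective k {l} {l′} {μ} (u , u-min , μ≈) (u′ , u′-min , μ≈′) i = begin
      l i                                     ≡⟨ cancel (l i) (act u (ρ k) i) ⟩
      (l i + act u (ρ k) i) - act u (ρ k) i   ≡⟨ cong₂ _-_ (μ≈ i) (sym (u≗u′ (ρ k) i)) ⟨
      μ i - act u′ (ρ k) i                    ≡⟨ cong (_- act u′ (ρ k) i) (μ≈′ i) ⟩
      (l′ i + act u′ (ρ k) i) - act u′ (ρ k) i ≡⟨ cancel (l′ i) (act u′ (ρ k) i) ⟨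
      l′ i                                    ∎
      where
      open ≡-Reasoning
      cancel : ∀ p q → p ≡ (p + q) - q
      cancel = solve 2 (λ p q → p := (p :+ q) :- q) refl
      u≗u′ : ∀ x → act u x ≈V act u′ x
      u≗u′ = minimal-words-agree u u′ (image-minimal k u-min μ≈) (image-minimal k u′-min μ≈′)

-- Only the values of k and m on simple roots enter ρ, and w_λ makes sense for every λ, so
-- W-invariance and λ ∈ P are not needed.
proposition6p3 : (d : ℕ) (G : Gram d) (Φ : List (Vec d)) (α ω : Fin d → Vec d)
    → IP.IsRootSystem G Φ → IP.IsBase G Φ α → IP.IsFundWeights G α ω
    → ((k m : Vec d → ℕ) → IP.Weyl.IsWInvariant G α ω Φ k → IP.Weyl.IsWInvariant G α ω Φ m
        → (λ₀ μ ν ν′ : Vec d) → IP.Weyl.InP G α ω λ₀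
        → IP.Weyl.Eta G α ω k λ₀ μ → IP.Weyl.Eta G α ω m μ ν
        → IP.Weyl.Eta G α ω (IP.Weyl._⊕_ G α ω k m) λ₀ ν′
        → ν ≈V ν′)
    × ((k : Vec d → ℕ) → IP.Weyl.IsWInvariant G α ω Φ k
        → (λ₀ λ₁ μ : Vec d) → IP.Weyl.InP G α ω λ₀ → IP.Weyl.InP G α ω λ₁
        → IP.Weyl.Eta G α ω k λ₀ μ → IP.Weyl.Eta G α ω k λ₁ μ
        → λ₀ ≈V λ₁)
proposition6p3 d G Φ α ω RS B FW =
  (λ k m _ _ _ _ _ _ _ → η-compose FW k m) , (λ k _ _ _ _ _ _ → η-injective FW k)
  where open RootSystem {ω = ω} RS B
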